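{- Let $T$ be a string, $\phi(i,j,w)$ an edit operation, $L=T[1..i-1]$, $R=T[j+1..|T|]$ and $T'=LwR$, with $|L|\ge|R|$ and $|w|\le |L|/2$. Suppose $T'$ is periodic, and write $T'=(uv)^ku$ with $k\ge 2$ an integer and $u,v$ strings such that $|uv|=\mathsf{per}(T')$. Suppose $|uvu|>|Lw|$ (so that $T' = uvuvu$). Let $x = \mathsf{cov}(\mathsf{bord}(uvu))$. Then $x$ is a cover of $uvu$ if and only if $\mathsf{range}(Lw,|x|) \ge |uvu| - \max\{|u|,|x|\}$.
   Context: A border of a non-empty string $S$ is a string that is both a proper prefix and a proper suffix of $S$; $\mathsf{bord}(S)$ is the longest border. If $S$ has a border $b$, $|S|-|b|$ is a period of $S$; $\mathsf{per}(S)$ is the smallest period, and $S$ is periodic if $\mathsf{per}(S)\le|S|/2$. A string $f$ is a cover of $S$ if every position of $S$ lies within some occurrence of $f$ in $S$; $\mathsf{cov}(S)$ is the shortest cover. For a string $S$ and $1\le k\le |S|$, $\mathsf{range}(S,k)$ is the largest integer $r$ such that $S[1..k]$ is a cover of $S[1..r]$. The edit $\phi(i,j,w)$ with $1\le j\le |T|$, $1\le i\le j+1$ produces $T'=T[1..i-1]\,w\,T[j+1..|T|]$. -}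

module Defs where

open import Data.Nat using (ℕ; zero; suc; _+_; _*_; _∸_; _≤_; _<_)
open import Data.List using (List; []; _++_; length; take; drop)
open import Data.Product using (Σ; ∃; ∃-syntax; _×_; _,_)
open import Relation.Binary.PropositionalEquality using (_≡_)

-- Strings over an arbitrary alphabet A are lists; positions are 0-based.

module _ {A : Set} where

  pow : List A → ℕ → List A
  pow s zero    = []
  pow s (suc k) = s ++ pow s k

  OccursAt : List A → List A → ℕ → Set
  OccursAt f S q = q + length f ≤ length S × take (length f) (drop q S) ≡ f

  IsCover : List A → List A → Set
  IsCover f S = ∀ p → p < length S →
    ∃[ q ] (q ≤ p × p < q + length f × OccursAt f S q)

  IsShortestCover : List A → List A → Set
  IsShortestCover x S = IsCover x S × (∀ y → IsCover y S → length x ≤ length y)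

  IsBorder : List A → List A → Set
  IsBorder b S = length b < length S × (∃[ z ] (b ++ z ≡ S)) × (∃[ y ] (y ++ b ≡ S))

  IsLongestBorder : List A → List A → Set
  IsLongestBorder b S = IsBorder b S × (∀ c → IsBorder c S → length c ≤ length b)

  IsPeriod : ℕ → List A → Set
  IsPeriod p S = ∃[ b ] (IsBorder b S × p ≡ length S ∸ length b)

  IsSmallestPeriod : ℕ → List A → Set
  IsSmallestPeriod p S = IsPeriod p S × (∀ q → IsPeriod q S → p ≤ q)

  Periodic : List A → Set
  Periodic S = ∃[ p ] (IsSmallestPeriod p S × 2 * p ≤ length S)

  IsRange : List A → ℕ → ℕ → Set
  IsRange S k r = r ≤ length S × IsCover (take k S) (take r S)
    × (∀ r′ → r′ ≤ length S → IsCover (take k S) (take r′ S) → r′ ≤ r)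

{-# OPTIONS --safe #-}
-- Write U = uvu, b = bord(U), x = cov(b) and s = |U| - max(|u|,|x|), positions being 0-based. As a cover
-- of b, x is a prefix and a suffix of U, so x occurs at s: inside the final u when |x| ≤ |u|, as a suffix
-- otherwise. Since Lw is a prefix of U with |U| + per ≤ 2|Lw|, also 2s + |x| ≤ 2|Lw|.
-- If x covers U, let q be an occurrence covering position s - 1. If q + |x| ≤ |Lw|, then x, the prefix of Lw
-- of length |x|, covers the prefix of Lw of length q + |x|, so range ≥ q + |x| ≥ s. Otherwise the bound
-- forces 0 < s - q ≤ |x|/2: x has a short period, and its prefix of length |x| - (s - q) covers x, hence b,
-- contradicting the minimality of x.
-- Conversely, if range ≥ s then x covers the prefix of U of length range and, as a cover of the suffix b,
-- which starts at |U| - |b| ≤ s, the rest of U; when |x| > |Lw| its prefix and suffix occurrences overlap.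
-- Of U = uvu the argument only uses that u is a nonempty border.
module Submission where

open import Defs
open import Data.Nat using (ℕ; zero; suc; pred; _+_; _*_; _∸_; _≤_; _<_; _⊔_; z≤n; s≤s)
open import Data.Nat.Properties
open import Data.Nat.Tactic.RingSolver using (solve)
open import Data.List using (List; []; _∷_; _++_; length; take; drop)
open import Data.List.Properties
  using (length-++; length-++-≤ˡ; length-++-≤ʳ; length-++-comm; length-take; length-drop; ++-assoc;
         take-all; take-take; take-drop; drop-drop; take++drop≡id)
open import Data.Product using (∃-syntax; _×_; _,_; proj₁; proj₂)
open import Data.Sum using (inj₁; inj₂)
open import Data.Empty using (⊥; ⊥-elim)
open import Relation.Nullary using (Dec; yes; no)
open import Relation.Binary.PropositionalEquality
open import Function.Bundles using (_⇔_; mk⇔)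

pred<self : ∀ {n} → 0 < n → pred n < n
pred<self {suc _} _ = ≤-refl

pred<⇒≤ : ∀ {n m} → pred n < m → n ≤ m
pred<⇒≤ {zero}  _ = z≤n
pred<⇒≤ {suc _} p = p

∸-+-∸ : ∀ {m n o} → o ≤ n → n ≤ m → (m ∸ n) + (n ∸ o) ≡ m ∸ o
∸-+-∸ {m} {n} {o} o≤n n≤m = begin
  (m ∸ n) + (n ∸ o)  ≡⟨ +-∸-assoc (m ∸ n) o≤n ⟨
  (m ∸ n) + n ∸ o    ≡⟨ cong (_∸ o) (m∸n+n≡m n≤m) ⟩
  m ∸ o              ∎
  where open ≡-Reasoning

shift-positive : ∀ {n a c} → a < n → c < n → 0 < n ∸ (a ⊔ c)
shift-positive a<n c<n = m<n⇒0<n∸m (⊔-lub a<n c<n)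

shift-bound : ∀ n a c → a ⊔ c ≤ n →
  (n ∸ (a ⊔ c)) + (n ∸ (a ⊔ c)) + c ≤ n + (n ∸ a)
shift-bound n a c a⊔c≤n = begin
  s + s + c        ≡⟨ +-assoc s s c ⟩
  s + (s + c)      ≤⟨ +-mono-≤ (∸-monoʳ-≤ n (m≤m⊔n a c)) s+c≤n ⟩
  (n ∸ a) + n      ≡⟨ +-comm (n ∸ a) n ⟩
  n + (n ∸ a)      ∎
  where
  open ≤-Reasoning
  s = n ∸ (a ⊔ c)
  s+c≤n : s + c ≤ n
  s+c≤n = begin
    s + c        ≤⟨ +-monoʳ-≤ s (m≤n⊔m a c) ⟩
    s + (a ⊔ c)  ≡⟨ m∸n+n≡m a⊔c≤n ⟩
    n            ∎

overhang⇒short-shift : ∀ q d c m → (q + d) + (q + d) + c ≤ m + m → m < q + c → d + d < c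
overhang⇒short-shift q d c m bound m<q+c = +-cancelˡ-< (q + q + c) (d + d) c (begin-strict
  (q + q + c) + (d + d)  ≡⟨ solve (q ∷ d ∷ c ∷ []) ⟩
  (q + d) + (q + d) + c  ≤⟨ bound ⟩
  m + m                  <⟨ +-mono-< m<q+c m<q+c ⟩
  (q + c) + (q + c)      ≡⟨ solve (q ∷ c ∷ []) ⟩
  (q + q + c) + c        ∎)
  where open ≤-Reasoning

period-bound⇒nonempty-border : ∀ {n a m} → n + (n ∸ a) ≤ m + m → m < n → 0 < a
period-bound⇒nonempty-border {n} {a} bound m<n =
  ∸-cancelʳ-< {a} {0} {n} (+-cancelˡ-< n (n ∸ a) n (≤-<-trans bound (+-mono-< m<n m<n)))

module _ {A : Set} where

  length-take≤n : ∀ n (xs : List A) → length (take n xs) ≤ n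
  length-take≤n n xs = ≤-trans (≤-reflexive (length-take n xs)) (m⊓n≤m n (length xs))

  length-take≤length : ∀ n (xs : List A) → length (take n xs) ≤ length xs
  length-take≤length n xs = ≤-trans (≤-reflexive (length-take n xs)) (m⊓n≤n n (length xs))

  length-take-≤ : ∀ {n} (xs : List A) → n ≤ length xs → length (take n xs) ≡ n
  length-take-≤ {n} xs n≤xs = trans (length-take n xs) (m≤n⇒m⊓n≡m n≤xs)

  take-length : ∀ (xs : List A) → take (length xs) xs ≡ xs
  take-length xs = take-all (length xs) xs ≤-refl

  take-++ˡ : ∀ n (xs ys : List A) → n ≤ length xs → take n (xs ++ ys) ≡ take n xs
  take-++ˡ zero    xs       ys _         = refl
  take-++ˡ (suc n) (x ∷ xs) ys (s≤s n≤xs) = cong (x ∷_) (take-++ˡ n xs ys n≤xs)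

  drop-length-++ : ∀ (xs ys : List A) → drop (length xs) (xs ++ ys) ≡ ys
  drop-length-++ []       ys = refl
  drop-length-++ (x ∷ xs) ys = drop-length-++ xs ys

  take-take-≤ : ∀ {m n} (xs : List A) → m ≤ n → take m (take n xs) ≡ take m xs
  take-take-≤ {m} {n} xs m≤n = trans (take-take m n xs) (cong (λ k → take k xs) (m≤n⇒m⊓n≡m m≤n))

  take-drop-take : ∀ n q {m} (xs : List A) → q + n ≤ m →
    take n (drop q (take m xs)) ≡ take n (drop q xs)
  take-drop-take n q {m} xs q+n≤m = begin
    take n (drop q (take m xs))        ≡⟨ take-drop n q (take m xs) ⟩
    drop q (take (q + n) (take m xs))  ≡⟨ cong (drop q) (take-take-≤ xs q+n≤m) ⟩
    drop q (take (q + n) xs)           ≡⟨ take-drop n q xs ⟨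
    take n (drop q xs)                 ∎
    where open ≡-Reasoning

  ++-prefix⇒take : ∀ (xs ys zs ws : List A) → xs ++ ys ≡ zs ++ ws → length xs ≤ length zs →
    take (length xs) zs ≡ xs
  ++-prefix⇒take xs ys zs ws eq xs≤zs = begin
    take (length xs) zs          ≡⟨ take-++ˡ (length xs) zs ws xs≤zs ⟨
    take (length xs) (zs ++ ws)  ≡⟨ cong (take (length xs)) eq ⟨
    take (length xs) (xs ++ ys)  ≡⟨ take-++ˡ (length xs) xs ys ≤-refl ⟩
    take (length xs) xs          ≡⟨ take-length xs ⟩
    xs                           ∎
    where open ≡-Reasoning

  occursAt-prefix : ∀ (xs ys : List A) → OccursAt xs (xs ++ ys) 0
  occursAt-prefix xs ys = length-++-≤ˡ xs , trans (take-++ˡ _ xs ys ≤-refl) (take-length xs)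

  occursAt-suffix : ∀ (xs ys : List A) → OccursAt ys (xs ++ ys) (length xs)
  occursAt-suffix xs ys = ≤-reflexive (sym (length-++ xs)) ,
    trans (cong (take (length ys)) (drop-length-++ xs ys)) (take-length ys)

  occursAt-self : ∀ (xs : List A) → OccursAt xs xs 0
  occursAt-self xs = ≤-refl , take-length xs

  take-occursAt : ∀ n (xs : List A) → OccursAt (take n xs) xs 0
  take-occursAt n xs =
    subst (λ S → OccursAt (take n xs) S 0) (take++drop≡id n xs) (occursAt-prefix (take n xs) (drop n xs))

  occursAt-take : ∀ {f S : List A} {q} n → q + length f ≤ n → OccursAt f S q → OccursAt f (take n S) q
  occursAt-take {f} {S} {q} n q+f≤n (q+f≤S , f≡) =
    subst (q + length f ≤_) (sym (length-take n S)) (⊓-glb q+f≤n q+f≤S) ,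
    trans (take-drop-take (length f) q S q+f≤n) f≡

  occursAt-take⁻ : ∀ {f S : List A} {q} n → OccursAt f (take n S) q → OccursAt f S q
  occursAt-take⁻ {f} {S} {q} n (q+f≤ , f≡) =
    ≤-trans q+f≤ (length-take≤length n S) ,
    trans (sym (take-drop-take (length f) q S (≤-trans q+f≤ (length-take≤n n S)))) f≡

  occursAt-drop : ∀ {f S : List A} {q} s → s ≤ length S → OccursAt f (drop s S) q → OccursAt f S (s + q)
  occursAt-drop {f} {S} {q} s s≤S (q+f≤ , f≡) =
    s+q+f≤S , trans (cong (take (length f)) (sym (drop-drop s q S))) f≡
    where
    open ≤-Reasoning
    s+q+f≤S : s + q + length f ≤ length S
    s+q+f≤S = begin
      s + q + length f    ≡⟨ +-assoc s q (length f) ⟩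
      s + (q + length f)  ≤⟨ +-monoʳ-≤ s (subst (q + length f ≤_) (length-drop s S) q+f≤) ⟩
      s + (length S ∸ s)  ≡⟨ m+[n∸m]≡n s≤S ⟩
      length S            ∎

  occursAt-trans : ∀ {x b S : List A} {q s} → OccursAt x b q → OccursAt b S s → OccursAt x S (s + q)
  occursAt-trans {x} {b} {q = q} {s} x∈b (s+b≤S , b≡) =
    occursAt-drop s (≤-trans (m≤m+n s (length b)) s+b≤S)
      (occursAt-take⁻ (length b) (subst (λ b′ → OccursAt x b′ q) (sym b≡) x∈b))

  cover-self : ∀ (xs : List A) → IsCover xs xs
  cover-self xs p p<xs = 0 , z≤n , p<xs , occursAt-self xs

  cover-window : ∀ {x b S : List A} {s} → OccursAt b S s → IsCover x b →
    ∀ p → s ≤ p → p < s + length b → ∃[ q ] (q ≤ p × p < q + length x × OccursAt x S q)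
  cover-window {x} {b} {s = s} b∈S x-cov p s≤p p<s+b
    with d , s+d≡p ← m≤n⇒∃[o]m+o≡n s≤p
    with q , q≤d , d<q+x , x∈b ←
           x-cov d (+-cancelˡ-< s d (length b) (subst (_< s + length b) (sym s+d≡p) p<s+b))
    = s + q ,
      subst (s + q ≤_) s+d≡p (+-monoʳ-≤ s q≤d) ,
      subst₂ _<_ s+d≡p (sym (+-assoc s q (length x))) (+-monoʳ-< s d<q+x) ,
      occursAt-trans x∈b b∈S

  cover-trans : ∀ {y x S : List A} → IsCover y x → IsCover x S → IsCover y S
  cover-trans y-cov x-cov p p<S with q , q≤p , p<q+x , x∈S ← x-cov p p<S =
    cover-window x∈S y-cov p q≤p p<q+x

  cover-glue : ∀ {x b₁ b₂ S : List A} {s} →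
    OccursAt b₁ S 0 → IsCover x b₁ → OccursAt b₂ S s → IsCover x b₂ →
    s ≤ length b₁ → s + length b₂ ≡ length S → IsCover x S
  cover-glue {b₁ = b₁} b₁∈S x-cov₁ b₂∈S x-cov₂ s≤b₁ s+b₂≡S p p<S with p <? length b₁
  ... | yes p<b₁ = cover-window b₁∈S x-cov₁ p z≤n p<b₁
  ... | no  p≮b₁ =
    cover-window b₂∈S x-cov₂ p (≤-trans s≤b₁ (≮⇒≥ p≮b₁)) (subst (p <_) (sym s+b₂≡S) p<S)

  cover-by-overlap : ∀ {x S : List A} {s} → OccursAt x S 0 → OccursAt x S s →
    s ≤ length x → s + length x ≡ length S → IsCover x S
  cover-by-overlap {x} x∈S x∈S′ = cover-glue x∈S (cover-self x) x∈S′ (cover-self x)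

  cover-take : ∀ {x S : List A} {a} → IsCover x S → OccursAt x S a → IsCover x (take (a + length x) S)
  cover-take {x} {S} {a} x-cov x∈S p p<
    with q , q≤p , p<q+x , x∈S′ ← x-cov p (<-≤-trans p< (length-take≤length (a + length x) S))
    with q ≤? a
  ... | yes q≤a = q , q≤p , p<q+x , occursAt-take (a + length x) (+-monoˡ-≤ (length x) q≤a) x∈S′
  ... | no  q≰a = a , ≤-trans (<⇒≤ (≰⇒> q≰a)) q≤p , <-≤-trans p< (length-take≤n (a + length x) S) ,
                  occursAt-take (a + length x) ≤-refl x∈S

  cover-starts : ∀ {x S : List A} → IsCover x S → 0 < length S → OccursAt x S 0
  cover-starts x-cov 0<S with x-cov 0 0<S
  ... | zero  , _  , _ , x∈S = x∈S
  ... | suc _ , () , _ , _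

  cover-ends : ∀ {x S : List A} → IsCover x S → 0 < length S → OccursAt x S (length S ∸ length x)
  cover-ends {x} {S} x-cov 0<S
    with q , _ , last<q+x , x∈S@(q+x≤S , _) ← x-cov (pred (length S)) (pred<self 0<S)
    = subst (OccursAt x S) q≡ x∈S
    where
    q≡ : q ≡ length S ∸ length x
    q≡ = trans (sym (m+n∸n≡m q (length x))) (cong (_∸ length x) (≤-antisym q+x≤S (pred<⇒≤ last<q+x)))

  period⇒cover : ∀ {x S : List A} {q t} → OccursAt x S q → OccursAt x S (q + t) → t + t ≤ length x →
    IsCover (take (length x ∸ t) x) x
  period⇒cover {x} {S} {q} {t} (_ , x≡) (_ , x≡′) t+t≤x =
    cover-by-overlap (take-occursAt l x) y∈x t≤y t+y≡x
    where
    l = length x ∸ t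
    t≤x : t ≤ length x
    t≤x = ≤-trans (m≤m+n t t) t+t≤x
    t+l≡x : t + l ≡ length x
    t+l≡x = m+[n∸m]≡n t≤x
    y≡l : length (take l x) ≡ l
    y≡l = length-take-≤ x (m∸n≤m (length x) t)
    t≤y : t ≤ length (take l x)
    t≤y = subst (t ≤_) (sym y≡l) (+-cancelˡ-≤ t t l (subst (t + t ≤_) (sym t+l≡x) t+t≤x))
    t+y≡x : t + length (take l x) ≡ length x
    t+y≡x = trans (cong (t +_) y≡l) t+l≡x
    y∈x : OccursAt (take l x) x t
    y∈x = ≤-reflexive t+y≡x , (begin
      take (length (take l x)) (drop t x)           ≡⟨ cong (λ n → take n (drop t x)) y≡l ⟩
      take l (drop t x)                             ≡⟨ cong (λ z → take l (drop t z)) x≡ ⟨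
      take l (drop t (take (length x) (drop q S)))  ≡⟨ take-drop-take l t (drop q S) (≤-reflexive t+l≡x) ⟩
      take l (drop t (drop q S))                    ≡⟨ cong (take l) (drop-drop q t S) ⟩
      take l (drop (q + t) S)                       ≡⟨ take-take-≤ (drop (q + t) S) (m∸n≤m (length x) t) ⟨
      take l (take (length x) (drop (q + t) S))     ≡⟨ cong (take l) x≡′ ⟩
      take l x                                      ∎)
      where open ≡-Reasoning

  shortest-cover-aperiodic : ∀ {x b S : List A} {q t} → IsShortestCover x b →
    OccursAt x S q → OccursAt x S (q + t) → 0 < t → t + t ≤ length x → ⊥
  shortest-cover-aperiodic {x} {t = t} (x-cov , x-min) x∈S x∈S′ 0<t t+t≤x =
    <⇒≱ (∸-monoʳ-< 0<t (≤-trans (m≤m+n t t) t+t≤x)) x≤x∸t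
    where
    x≤x∸t : length x ≤ length x ∸ t
    x≤x∸t = ≤-trans (x-min _ (cover-trans (period⇒cover x∈S x∈S′ t+t≤x) x-cov))
                    (length-take≤n (length x ∸ t) x)

  border-prefix : ∀ {b S : List A} → IsBorder b S → OccursAt b S 0
  border-prefix {b} (_ , (z , b++z≡S) , _) = subst (λ S → OccursAt b S 0) b++z≡S (occursAt-prefix b z)

  border-suffix : ∀ {b S : List A} → IsBorder b S → OccursAt b S (length S ∸ length b)
  border-suffix {b} {S} (_ , _ , (y , y++b≡S)) = subst₂ (OccursAt b) y++b≡S y≡ (occursAt-suffix y b)
    where
    open ≡-Reasoning
    y≡ : length y ≡ length S ∸ length b
    y≡ = begin
      length y                        ≡⟨ m+n∸n≡m (length y) (length b) ⟨
      length y + length b ∸ length b  ≡⟨ cong (_∸ length b) (length-++ y) ⟨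
      length (y ++ b) ∸ length b      ≡⟨ cong (λ S → length S ∸ length b) y++b≡S ⟩
      length S ∸ length b             ∎

  border-cover-prefix : ∀ {x b S : List A} → IsBorder b S → IsCover x b → 0 < length b → OccursAt x S 0
  border-cover-prefix b-border x-cov 0<b = occursAt-trans (cover-starts x-cov 0<b) (border-prefix b-border)

  border-cover-suffix : ∀ {x b S : List A} → IsBorder b S → IsCover x b → 0 < length b →
    OccursAt x S (length S ∸ length x)
  border-cover-suffix {x} {S = S} b-border@(b<S , _) x-cov 0<b =
    subst (OccursAt x S) (∸-+-∸ (proj₁ (cover-starts x-cov 0<b)) (<⇒≤ b<S))
      (occursAt-trans (cover-ends x-cov 0<b) (border-suffix b-border))

  border-cover-shift : ∀ {u b x S : List A} → IsBorder u S → IsBorder b S → length u ≤ length b →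
    IsCover x b → 0 < length u → OccursAt x S (length S ∸ (length u ⊔ length x))
  border-cover-shift {u} {x = x} {S} u-border b-border u≤b x-cov 0<u with ≤-total (length x) (length u)
  ... | inj₁ x≤u = subst (OccursAt x S) shift≡ (occursAt-trans x∈u (border-suffix u-border))
    where
    x∈u : OccursAt x u 0
    x∈u = subst (λ S → OccursAt x S 0) (proj₂ (border-prefix u-border))
            (occursAt-take (length u) x≤u (border-cover-prefix b-border x-cov (≤-trans 0<u u≤b)))
    shift≡ : length S ∸ length u + 0 ≡ length S ∸ (length u ⊔ length x)
    shift≡ = trans (+-identityʳ _) (cong (length S ∸_) (sym (m≥n⇒m⊔n≡m x≤u)))
  ... | inj₂ u≤x = subst (OccursAt x S) (cong (length S ∸_) (sym (m≤n⇒m⊔n≡n u≤x)))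
                     (border-cover-suffix b-border x-cov (≤-trans 0<u u≤b))

  cover⇒range : ∀ {U P x b : List A} {s r} → take (length P) U ≡ P → OccursAt x U 0 →
    IsShortestCover x b → OccursAt x U s → 0 < s → s + s + length x ≤ length P + length P →
    IsRange P (length x) r → IsCover x U → s ≤ r
  cover⇒range {U} {P} {x} {s = suc t} P≡ x∈U x-short x∈U′@(s+x≤U , _) _ bound (_ , _ , r-max) x-cov
    with q , q≤t , t<q+x , x∈U″ ← x-cov t (≤-trans (m≤m+n (suc t) (length x)) s+x≤U)
    with q + length x ≤? length P
  ... | yes q+x≤P =
    ≤-trans t<q+x (r-max (q + length x) q+x≤P (subst₂ IsCover x≡ prefix≡ (cover-take x-cov x∈U″)))
    where
    x≡ : x ≡ take (length x) P
    x≡ = trans (sym (proj₂ x∈U))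
           (trans (sym (take-take-≤ U (≤-trans (m≤n+m (length x) q) q+x≤P))) (cong (take (length x)) P≡))
    prefix≡ : take (q + length x) U ≡ take (q + length x) P
    prefix≡ = trans (sym (take-take-≤ U q+x≤P)) (cong (take (q + length x)) P≡)
  ... | no q+x≰P =
    ⊥-elim (shortest-cover-aperiodic x-short x∈U″ (subst (OccursAt x U) (sym q+d≡s) x∈U′)
              (m<n⇒0<n∸m (s≤s q≤t))
              (<⇒≤ (overhang⇒short-shift q d (length x) (length P) bound′ (≰⇒> q+x≰P))))
    where
    d = suc t ∸ q
    q+d≡s : q + d ≡ suc t
    q+d≡s = m+[n∸m]≡n (m≤n⇒m≤1+n q≤t)
    bound′ : (q + d) + (q + d) + length x ≤ length P + length P
    bound′ = subst (λ s → s + s + length x ≤ length P + length P) (sym q+d≡s) bound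

  range⇒cover : ∀ {U P x b : List A} {r} → take (length P) U ≡ P → length U ≤ length P + length P →
    IsBorder b U → IsCover x b → 0 < length b → length U ∸ length b ≤ r →
    IsRange P (length x) r → IsCover x U
  range⇒cover {U} {P} {x} {r = r} P≡ U≤P+P b-border x-cov 0<b s≤r (r≤P , r-cov , _) =
    by-length (length x ≤? length P)
    where
    x∈U : OccursAt x U 0
    x∈U = border-cover-prefix b-border x-cov 0<b
    by-length : Dec (length x ≤ length P) → IsCover x U
    by-length (yes x≤P) = cover-glue (take-occursAt r U) prefix-cov (border-suffix b-border) x-cov
      (subst (_ ≤_) (sym (length-take-≤ U r≤U)) s≤r) (m∸n+n≡m (<⇒≤ (proj₁ b-border)))
      where
      r≤U : r ≤ length U
      r≤U = ≤-trans r≤P (subst (_≤ length U) (cong length P≡) (length-take≤length (length P) U))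
      prefix-cov : IsCover x (take r U)
      prefix-cov = subst₂ IsCover
        (trans (cong (take (length x)) (sym P≡)) (trans (take-take-≤ U x≤P) (proj₂ x∈U)))
        (trans (cong (take r) (sym P≡)) (take-take-≤ U r≤P))
        r-cov
    by-length (no x≰P) =
      cover-by-overlap x∈U (border-cover-suffix b-border x-cov 0<b) e≤x (m∸n+n≡m (proj₁ x∈U))
      where
      P≤x : length P ≤ length x
      P≤x = <⇒≤ (≰⇒> x≰P)
      e≤x : length U ∸ length x ≤ length x
      e≤x = ≤-trans (∸-monoˡ-≤ (length x) (≤-trans U≤P+P (+-mono-≤ P≤x P≤x)))
                    (≤-reflexive (m+n∸n≡m (length x) (length x)))

  cover⇔range : ∀ {U P u b x : List A} {r} →
    IsBorder u U → 0 < length u → IsLongestBorder b U → IsShortestCover x b →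
    take (length P) U ≡ P → length U + (length U ∸ length u) ≤ length P + length P →
    IsRange P (length x) r →
    IsCover x U ⇔ (length U ∸ (length u ⊔ length x) ≤ r)
  cover⇔range {U} {P} {u} {b} {x} u-border 0<u (b-border , b-longest) x-short@(x-cov , _) P≡ bound range =
    mk⇔ (cover⇒range P≡ x∈U x-short (border-cover-shift u-border b-border u≤b x-cov 0<u)
           shift-pos shift-bound′ range)
        (λ shift≤r → range⇒cover P≡ (≤-trans (m≤m+n _ _) bound) b-border x-cov 0<b
                       (≤-trans b-shift≤shift shift≤r) range)
    where
    u≤b : length u ≤ length b
    u≤b = b-longest u u-border
    0<b : 0 < length b
    0<b = ≤-trans 0<u u≤b
    x∈U : OccursAt x U 0
    x∈U = border-cover-prefix b-border x-cov 0<b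
    x≤b : length x ≤ length b
    x≤b = proj₁ (cover-starts x-cov 0<b)
    x<U : length x < length U
    x<U = ≤-<-trans x≤b (proj₁ b-border)
    shift-pos : 0 < length U ∸ (length u ⊔ length x)
    shift-pos = shift-positive (proj₁ u-border) x<U
    shift-bound′ : let s = length U ∸ (length u ⊔ length x) in s + s + length x ≤ length P + length P
    shift-bound′ = ≤-trans (shift-bound (length U) (length u) (length x)
                             (⊔-lub (<⇒≤ (proj₁ u-border)) (<⇒≤ x<U))) bound
    b-shift≤shift : length U ∸ length b ≤ length U ∸ (length u ⊔ length x)
    b-shift≤shift = ∸-monoʳ-≤ (length U) (⊔-lub u≤b x≤b)

  uvu-period : ∀ (u v : List A) → length (u ++ v ++ u) ∸ length u ≡ length (u ++ v)
  uvu-period u v = begin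
    length (u ++ v ++ u) ∸ length u        ≡⟨ cong (λ z → length z ∸ length u) (++-assoc u v u) ⟨
    length ((u ++ v) ++ u) ∸ length u      ≡⟨ cong (_∸ length u) (length-++ (u ++ v)) ⟩
    length (u ++ v) + length u ∸ length u  ≡⟨ m+n∸n≡m (length (u ++ v)) (length u) ⟩
    length (u ++ v)                        ∎
    where open ≡-Reasoning

  uvu-border : ∀ (u v : List A) → 0 < length u → IsBorder u (u ++ v ++ u)
  uvu-border u v 0<u = u<uvu , (v ++ u , refl) , (u ++ v , ++-assoc u v u)
    where
    u<uvu : length u < length (u ++ v ++ u)
    u<uvu = subst (length u <_) (sym (length-++ u)) (m<m+n (length u) (≤-trans 0<u (length-++-≤ʳ u {v})))

  pow-unfold-uvu : ∀ (u v : List A) k → pow (u ++ v) (2 + k) ++ u ≡ (u ++ v ++ u) ++ v ++ pow (u ++ v) k ++ u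
  pow-unfold-uvu u v k = begin
    ((u ++ v) ++ (u ++ v) ++ W) ++ u   ≡⟨ ++-assoc (u ++ v) ((u ++ v) ++ W) u ⟩
    (u ++ v) ++ ((u ++ v) ++ W) ++ u   ≡⟨ ++-assoc u v _ ⟩
    u ++ v ++ ((u ++ v) ++ W) ++ u     ≡⟨ cong (λ z → u ++ v ++ z) (++-assoc (u ++ v) W u) ⟩
    u ++ v ++ (u ++ v) ++ W ++ u       ≡⟨ cong (λ z → u ++ v ++ z) (++-assoc u v (W ++ u)) ⟩
    u ++ v ++ u ++ v ++ W ++ u         ≡⟨ cong (u ++_) (++-assoc v u _) ⟨
    u ++ (v ++ u) ++ v ++ W ++ u       ≡⟨ ++-assoc u (v ++ u) _ ⟨
    (u ++ v ++ u) ++ v ++ W ++ u       ∎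
    where
    open ≡-Reasoning
    W = pow (u ++ v) k

  pow-prefix⇒uvu-prefix : ∀ {P R : List A} (u v : List A) k → P ++ R ≡ pow (u ++ v) (2 + k) ++ u →
    length P ≤ length (u ++ v ++ u) → take (length P) (u ++ v ++ u) ≡ P
  pow-prefix⇒uvu-prefix {P} {R} u v k P++R≡ =
    ++-prefix⇒take P R (u ++ v ++ u) _ (trans P++R≡ (pow-unfold-uvu u v k))

  pow-prefix⇒period-bound : ∀ {P R : List A} (u v : List A) k → P ++ R ≡ pow (u ++ v) (2 + k) ++ u →
    length R ≤ length P →
    length (u ++ v ++ u) + (length (u ++ v ++ u) ∸ length u) ≤ length P + length P
  pow-prefix⇒period-bound {P} {R} u v k P++R≡ R≤P = begin
    length U + (length U ∸ length u)  ≡⟨ cong (length U +_) (uvu-period u v) ⟩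
    length U + length (u ++ v)        ≤⟨ +-monoʳ-≤ (length U) uv≤Z ⟩
    length U + length Z               ≡⟨ length-++ U ⟨
    length (U ++ Z)                   ≡⟨ cong length (trans P++R≡ (pow-unfold-uvu u v k)) ⟨
    length (P ++ R)                   ≡⟨ length-++ P ⟩
    length P + length R               ≤⟨ +-monoʳ-≤ (length P) R≤P ⟩
    length P + length P               ∎
    where
    open ≤-Reasoning
    U = u ++ v ++ u
    Z = v ++ pow (u ++ v) k ++ u
    uv≤Z : length (u ++ v) ≤ length Z
    uv≤Z = begin
      length (u ++ v)                          ≡⟨ length-++-comm u v ⟩
      length (v ++ u)                          ≡⟨ length-++ v ⟩
      length v + length u                      ≤⟨ +-monoʳ-≤ (length v) (length-++-≤ʳ u {pow (u ++ v) k}) ⟩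
      length v + length (pow (u ++ v) k ++ u)  ≡⟨ length-++ v ⟨
      length Z                                 ∎

lemma17 : {A : Set} (T w : List A) (i j : ℕ) →
    1 ≤ j → j ≤ length T → 1 ≤ i → i ≤ j + 1 →
    length (drop j T) ≤ length (take (i ∸ 1) T) →
    2 * length w ≤ length (take (i ∸ 1) T) →
    Periodic (take (i ∸ 1) T ++ w ++ drop j T) →
    (u v : List A) (k : ℕ) → 2 ≤ k →
    take (i ∸ 1) T ++ w ++ drop j T ≡ pow (u ++ v) k ++ u →
    IsSmallestPeriod (length (u ++ v)) (take (i ∸ 1) T ++ w ++ drop j T) →
    length (take (i ∸ 1) T ++ w) < length (u ++ v ++ u) →
    (b x : List A) → IsLongestBorder b (u ++ v ++ u) → IsShortestCover x b →
    (r : ℕ) → IsRange (take (i ∸ 1) T ++ w) (length x) r →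
    IsCover x (u ++ v ++ u) ⇔ (length (u ++ v ++ u) ∸ (length u ⊔ length x) ≤ r)
lemma17 T w i j _ _ _ _ R≤L _ _ u v (suc (suc k)) (s≤s (s≤s _)) T′≡ _ P<U b x b-longest x-short r range =
  cover⇔range (uvu-border u v 0<u) 0<u b-longest x-short
    (pow-prefix⇒uvu-prefix u v k P++R≡ (<⇒≤ P<U)) bound range
  where
  L = take (i ∸ 1) T
  R = drop j T
  P++R≡ : (L ++ w) ++ R ≡ pow (u ++ v) (2 + k) ++ u
  P++R≡ = trans (++-assoc L w R) T′≡
  bound : length (u ++ v ++ u) + (length (u ++ v ++ u) ∸ length u) ≤ length (L ++ w) + length (L ++ w)
  bound = pow-prefix⇒period-bound {P = L ++ w} u v k P++R≡ (≤-trans R≤L (length-++-≤ˡ L))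
  0<u : 0 < length u
  0<u = period-bound⇒nonempty-border bound P<U
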